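{- Let $\Gamma$ be a finite nonabelian group. Then $rc(CG(\Gamma))\leq 3$ if and only if either $\Gamma$ has a nontrivial center, or $\Gamma$ has a trivial center and $\Gamma$ has at most three maximal abelian subgroups of order $2$.
   Context: For a finite group $\Gamma$, the commuting graph $CG(\Gamma)$ is the simple graph with vertex set $\Gamma$ in which two distinct elements $a,b$ are adjacent if and only if $ab=ba$. For a connected graph $G$, an edge coloring (adjacent edges may share colors) makes $G$ rainbow-connected if every two distinct vertices are joined by a path whose edges all have pairwise distinct colors; the rainbow connection number $rc(G)$ is the minimum number of colors in such a coloring. The center of $\Gamma$ is $Z(\Gamma)=\{z\in\Gamma: za=az \text{ for all } a\in\Gamma\}$; it is trivial if it equals $\{e\}$. A maximal abelian subgroup of $\Gamma$ is an abelian subgroup not properly contained in any other abelian subgroup of $\Gamma$. -}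

module Defs where

open import Data.Nat using (ℕ; _≤_)
open import Data.Fin using (Fin)
open import Data.Fin.Subset using (Subset; _∈_; _⊆_; ∣_∣)
open import Data.List using (List; []; _∷_; length; map)
open import Data.List.Membership.Propositional using () renaming (_∈_ to _∈ₗ_)
open import Data.List.Relation.Unary.Unique.Propositional using (Unique)
open import Data.List.Relation.Unary.AllPairs using (AllPairs)
open import Data.Product using (Σ; _×_; ∃; ∃-syntax; _,_)
open import Data.Sum using (_⊎_)
open import Relation.Binary.PropositionalEquality using (_≡_; _≢_)
open import Relation.Nullary using (¬_)
open import Function.Bundles using (_⇔_)
open import Data.Unit using () renaming (⊤ to ⊤')
open import Data.Empty using () renaming (⊥ to ⊥')

-- Finite groups: every finite group is (isomorphic to) a group whose
-- carrier is Fin order, given by its multiplication table.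

record FinGroup : Set where
  field
    order     : ℕ
    _∙_       : Fin order → Fin order → Fin order
    e         : Fin order
    inv       : Fin order → Fin order
    assoc     : ∀ a b c → (a ∙ b) ∙ c ≡ a ∙ (b ∙ c)
    identityˡ : ∀ a → e ∙ a ≡ a
    identityʳ : ∀ a → a ∙ e ≡ a
    inverseˡ  : ∀ a → inv a ∙ a ≡ e
    inverseʳ  : ∀ a → a ∙ inv a ≡ e

module _ (G : FinGroup) where
  open FinGroup G

  Commute : Fin order → Fin order → Set
  Commute a b = a ∙ b ≡ b ∙ a

  IsAbelian : Set
  IsAbelian = ∀ a b → Commute a b

  IsCentral : Fin order → Set
  IsCentral z = ∀ a → Commute z a

  NontrivialCenter : Set
  NontrivialCenter = ∃[ z ] (z ≢ e × IsCentral z)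

  TrivialCenter : Set
  TrivialCenter = ∀ z → IsCentral z → z ≡ e

  IsSubgroup : Subset order → Set
  IsSubgroup S = (e ∈ S)
               × (∀ {a b} → a ∈ S → b ∈ S → (a ∙ b) ∈ S)
               × (∀ {a} → a ∈ S → inv a ∈ S)

  IsAbelianSubgroup : Subset order → Set
  IsAbelianSubgroup S = IsSubgroup S × (∀ {a b} → a ∈ S → b ∈ S → Commute a b)

  IsMaximalAbelianSubgroup : Subset order → Set
  IsMaximalAbelianSubgroup S =
    IsAbelianSubgroup S × (∀ T → IsAbelianSubgroup T → S ⊆ T → T ⊆ S)

  IsMaxAbelianOfOrder2 : Subset order → Set
  IsMaxAbelianOfOrder2 S = IsMaximalAbelianSubgroup S × ∣ S ∣ ≡ 2

  -- "at most three maximal abelian subgroups of order 2":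
  -- all of them occur in some list of length at most 3
  AtMostThreeMaxAbelianOfOrder2 : Set
  AtMostThreeMaxAbelianOfOrder2 =
    ∃[ L ] (length L ≤ 3 × (∀ S → IsMaxAbelianOfOrder2 S → S ∈ₗ L))

record SimpleGraph (n : ℕ) : Set₁ where
  field
    Adj     : Fin n → Fin n → Set
    irrefl  : ∀ {u} → ¬ Adj u u
    symm    : ∀ {u v} → Adj u v → Adj v u

module _ {n : ℕ} (Gr : SimpleGraph n) where
  open SimpleGraph Gr

  -- an edge colouring with colours Fin k: a colour for each unordered
  -- pair (symmetric function); only its values on edges matter
  record EdgeColouring (k : ℕ) : Set where
    field
      colour : Fin n → Fin n → Fin k
      sym    : ∀ u v → colour u v ≡ colour v u

  IsWalk : List (Fin n) → Set
  IsWalk []            = ⊤'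
  IsWalk (u ∷ [])      = ⊤'
  IsWalk (u ∷ v ∷ vs)  = Adj u v × IsWalk (v ∷ vs)

  edgeColours : ∀ {k} → EdgeColouring k → List (Fin n) → List (Fin k)
  edgeColours c []           = []
  edgeColours c (u ∷ [])     = []
  edgeColours c (u ∷ v ∷ vs) = EdgeColouring.colour c u v ∷ edgeColours c (v ∷ vs)

  IsRainbowPath : ∀ {k} → EdgeColouring k → Fin n → Fin n → List (Fin n) → Set
  IsRainbowPath c u v [] = ⊥'
  IsRainbowPath c u v (w ∷ ws) =
    u ≡ w × Last v (w ∷ ws) × IsWalk (w ∷ ws) × Unique (w ∷ ws)
      × Unique (edgeColours c (w ∷ ws))
    where
    Last : Fin n → List (Fin n) → Set
    Last x []           = ⊥'
    Last x (y ∷ [])     = x ≡ y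
    Last x (y ∷ z ∷ zs) = Last x (z ∷ zs)

  IsRainbowConnected : ∀ {k} → EdgeColouring k → Set
  IsRainbowConnected c = ∀ u v → u ≢ v → ∃[ p ] IsRainbowPath c u v p

  rc≤ : ℕ → Set
  rc≤ k = Σ (EdgeColouring k) IsRainbowConnected

CG : (G : FinGroup) → SimpleGraph (FinGroup.order G)
CG G = record
  { Adj    = λ a b → a ≢ b × Commute G a b
  ; irrefl = λ { (a≢a , _) → a≢a refl' }
  ; symm   = λ { (a≢b , ab) → (λ eq → a≢b (sym' eq)) , sym' ab }
  }
  where open import Relation.Binary.PropositionalEquality
          using () renaming (refl to refl'; sym to sym')

{-# OPTIONS --safe #-}
-- CG(Γ) has the dominating vertex e, and t ≠ e is a leaf (pendant vertex) of CG(Γ), i.e. has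
-- centraliser {e, t}, exactly when {e, t} is a maximal abelian subgroup of order 2. In a rainbow
-- colouring two leaves t, t′ can only be joined by the path t e t′, so the edges from e to the
-- leaves get pairwise distinct colours and there are at most three leaves. Conversely, given at
-- most three leaves, give the edges from e to the leaves distinct colours, label every other
-- vertex x ≠ e by 0 or 1 so that it has a neighbour x′ ≠ e with the other label, give the edge
-- e x the label of x and every edge avoiding e the colour 2. Then u and v are joined by u e v,
-- or by u x′ e v, or by u e x′ v. A nonabelian group with nontrivial centre has no leaves at all.
module Submission where

open import Algebra.Bundles using (Group)
import Algebra.Properties.Group as GroupProperties
open import Data.Bool using (Bool; true; false; not)
open import Data.Bool.Properties using (not-¬)
open import Data.Empty using (⊥-elim)
open import Data.Fin using (Fin; zero; suc; _≟_; inject≤)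
open import Data.Fin.Properties using (any?; all?; inject≤-injective)
open import Data.Fin.Subset using (Subset; inside; outside; ⁅_⁆; _∪_; _∈_; _⊆_; ∣_∣)
open import Data.Fin.Subset.Properties
  using (x∈⁅x⁆; x∈⁅y⁆⇒x≡y; ∣⁅x⁆∣≡1; x∈p∪q⁺; x∈p∪q⁻; p⊆p∪q; ⊆-antisym; p⊆q⇒∣p∣≤∣q∣; p⊂q⇒∣p∣<∣q∣; _∈?_)
open import Data.List as List using (List; []; _∷_; length; map; mapMaybe; allFin)
open import Data.List.Membership.Propositional using () renaming (_∈_ to _∈ₗ_)
open import Data.List.Membership.Propositional.Properties using (∈-allFin; ∈-map⁺)
open import Data.List.Properties using (length-map; length-mapMaybe; length-tabulate)
open import Data.List.Relation.Unary.All using ([]; _∷_)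
open import Data.List.Relation.Unary.All.Properties using (All¬⇒¬Any)
open import Data.List.Relation.Unary.AllPairs using ([]; _∷_)
open import Data.List.Relation.Unary.Any as Any using (Any; here; there)
open import Data.List.Relation.Unary.Any.Properties using (mapMaybe⁺; map⁺; lookup-index)
open import Data.Maybe using (Maybe; just; nothing)
import Data.Maybe.Relation.Unary.Any as MaybeAny
open import Data.Nat using (ℕ; zero; suc; _≤_; _<_; _+_; s≤s; z≤n)
open import Data.Nat.Properties using (≤-antisym; ≤-trans; ≤-reflexive; <-irrefl; +-suc; +-monoʳ-≤; n≤1+n)
open import Data.Product using (Σ; ∃; ∃-syntax; _×_; _,_; proj₁; proj₂)
open import Data.Sum using (_⊎_; inj₁; inj₂; [_,_]′)
open import Data.Unit using (tt)
open import Data.Vec using ([]; _∷_; here; there)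
open import Function using (_∘_; id; case_of_)
open import Function.Bundles using (_⇔_; mk⇔)
open import Level using (Level; 0ℓ)
open import Relation.Binary.Core using (Rel)
open import Relation.Binary.Definitions using (Decidable; Symmetric; Irreflexive)
open import Relation.Binary.PropositionalEquality
open import Relation.Nullary using (¬_; Dec; yes; no; does)
open import Relation.Nullary.Decidable using (_×-dec_; _→-dec_; ¬?; toSum; map′; decidable-stable)
open import Relation.Unary as U using (Pred)

open import Defs

∣p∪q∣≤∣p∣+∣q∣ : ∀ {n} (p q : Subset n) → ∣ p ∪ q ∣ ≤ ∣ p ∣ + ∣ q ∣
∣p∪q∣≤∣p∣+∣q∣ []            []            = z≤n
∣p∪q∣≤∣p∣+∣q∣ (outside ∷ p) (outside ∷ q) = ∣p∪q∣≤∣p∣+∣q∣ p q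
∣p∪q∣≤∣p∣+∣q∣ (outside ∷ p) (inside ∷ q)  = ≤-trans (s≤s (∣p∪q∣≤∣p∣+∣q∣ p q)) (≤-reflexive (sym (+-suc _ _)))
∣p∪q∣≤∣p∣+∣q∣ (inside ∷ p)  (outside ∷ q) = s≤s (∣p∪q∣≤∣p∣+∣q∣ p q)
∣p∪q∣≤∣p∣+∣q∣ (inside ∷ p)  (inside ∷ q)  = s≤s (≤-trans (∣p∪q∣≤∣p∣+∣q∣ p q) (+-monoʳ-≤ ∣ p ∣ (n≤1+n ∣ q ∣)))

module _ {n : ℕ} where

  x∈⁅x⁆∪⁅y⁆ : ∀ (x y : Fin n) → x ∈ ⁅ x ⁆ ∪ ⁅ y ⁆
  x∈⁅x⁆∪⁅y⁆ x y = x∈p∪q⁺ (inj₁ (x∈⁅x⁆ x))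

  y∈⁅x⁆∪⁅y⁆ : ∀ (x y : Fin n) → y ∈ ⁅ x ⁆ ∪ ⁅ y ⁆
  y∈⁅x⁆∪⁅y⁆ x y = x∈p∪q⁺ (inj₂ (x∈⁅x⁆ y))

  z∈⁅x⁆∪⁅y⁆⇒z≡x⊎z≡y : ∀ {z} (x y : Fin n) → z ∈ ⁅ x ⁆ ∪ ⁅ y ⁆ → z ≡ x ⊎ z ≡ y
  z∈⁅x⁆∪⁅y⁆⇒z≡x⊎z≡y x y z∈ with x∈p∪q⁻ ⁅ x ⁆ ⁅ y ⁆ z∈
  ... | inj₁ z∈⁅x⁆ = inj₁ (x∈⁅y⁆⇒x≡y x z∈⁅x⁆)
  ... | inj₂ z∈⁅y⁆ = inj₂ (x∈⁅y⁆⇒x≡y y z∈⁅y⁆)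

  ⁅x⁆∪⁅y⁆⊆p : ∀ {x y} {p : Subset n} → x ∈ p → y ∈ p → ⁅ x ⁆ ∪ ⁅ y ⁆ ⊆ p
  ⁅x⁆∪⁅y⁆⊆p {x} {y} x∈p y∈p z∈ with z∈⁅x⁆∪⁅y⁆⇒z≡x⊎z≡y x y z∈
  ... | inj₁ refl = x∈p
  ... | inj₂ refl = y∈p

  ∣⁅x⁆∪⁅y⁆∣≡2 : ∀ {x y : Fin n} → x ≢ y → ∣ ⁅ x ⁆ ∪ ⁅ y ⁆ ∣ ≡ 2
  ∣⁅x⁆∪⁅y⁆∣≡2 {x} {y} x≢y = ≤-antisym upper lower
    where
    upper : ∣ ⁅ x ⁆ ∪ ⁅ y ⁆ ∣ ≤ 2
    upper = subst₂ (λ a b → ∣ ⁅ x ⁆ ∪ ⁅ y ⁆ ∣ ≤ a + b) (∣⁅x⁆∣≡1 x) (∣⁅x⁆∣≡1 y) (∣p∪q∣≤∣p∣+∣q∣ ⁅ x ⁆ ⁅ y ⁆)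
    lower : 2 ≤ ∣ ⁅ x ⁆ ∪ ⁅ y ⁆ ∣
    lower = subst (λ a → a < ∣ ⁅ x ⁆ ∪ ⁅ y ⁆ ∣) (∣⁅x⁆∣≡1 x)
      (p⊂q⇒∣p∣<∣q∣ (p⊆p∪q ⁅ y ⁆ , y , y∈⁅x⁆∪⁅y⁆ x y , λ y∈⁅x⁆ → x≢y (sym (x∈⁅y⁆⇒x≡y x y∈⁅x⁆))))

  ∣p∣≡2⇒p≡⁅x⁆∪⁅y⁆ : ∀ {x} {p : Subset n} → ∣ p ∣ ≡ 2 → x ∈ p → ∃[ y ] (y ≢ x × p ≡ ⁅ x ⁆ ∪ ⁅ y ⁆)
  ∣p∣≡2⇒p≡⁅x⁆∪⁅y⁆ {x} {p} ∣p∣≡2 x∈p with any? (λ y → (y ∈? p) ×-dec ¬? (y ≟ x))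
  ... | yes (y , y∈p , y≢x) = y , y≢x , ⊆-antisym p⊆⁅x⁆∪⁅y⁆ (⁅x⁆∪⁅y⁆⊆p x∈p y∈p)
    where
    p⊆⁅x⁆∪⁅y⁆ : p ⊆ ⁅ x ⁆ ∪ ⁅ y ⁆
    p⊆⁅x⁆∪⁅y⁆ {z} z∈p with z ≟ x | z ≟ y
    ... | yes refl | _        = x∈⁅x⁆∪⁅y⁆ x y
    ... | no _     | yes refl = y∈⁅x⁆∪⁅y⁆ x y
    ... | no z≢x   | no z≢y   = ⊥-elim (<-irrefl refl (subst₂ _<_ (∣⁅x⁆∪⁅y⁆∣≡2 (y≢x ∘ sym)) ∣p∣≡2
      (p⊂q⇒∣p∣<∣q∣ (⁅x⁆∪⁅y⁆⊆p x∈p y∈p , z , z∈p , [ z≢x , z≢y ]′ ∘ z∈⁅x⁆∪⁅y⁆⇒z≡x⊎z≡y x y))))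
  ... | no ∄y = ⊥-elim (<-irrefl refl (subst₂ _≤_ ∣p∣≡2 (∣⁅x⁆∣≡1 x) (p⊆q⇒∣p∣≤∣q∣ p⊆⁅x⁆)))
    where
    p⊆⁅x⁆ : p ⊆ ⁅ x ⁆
    p⊆⁅x⁆ {z} z∈p with z ≟ x
    ... | yes refl = x∈⁅x⁆ x
    ... | no z≢x   = ⊥-elim (∄y (z , z∈p , z≢x))

module _ {ℓ : Level} where

  subset : ∀ {n} {P : Pred (Fin n) ℓ} → U.Decidable P → Subset n
  subset {zero}  P? = []
  subset {suc n} P? = does (P? zero) ∷ subset (P? ∘ suc)

  ∈-subset⁺ : ∀ {n} {P : Pred (Fin n) ℓ} (P? : U.Decidable P) {x} → P x → x ∈ subset P?
  ∈-subset⁺ P? {zero} Px with P? zero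
  ... | yes _  = here
  ... | no ¬Px = ⊥-elim (¬Px Px)
  ∈-subset⁺ P? {suc x} Px = there (∈-subset⁺ (P? ∘ suc) Px)

  ∈-subset⁻ : ∀ {n} {P : Pred (Fin n) ℓ} (P? : U.Decidable P) {x} → x ∈ subset P? → P x
  ∈-subset⁻ P? {zero} x∈ with P? zero | x∈
  ... | yes Px | _  = Px
  ... | no _   | ()
  ∈-subset⁻ P? {suc x} (there x∈) = ∈-subset⁻ (P? ∘ suc) x∈

InjectiveOn : ∀ {a b ℓ} {A : Set a} {B : Set b} → Pred A ℓ → (A → B) → Set _
InjectiveOn Q f = ∀ {x y} → Q x → Q y → f x ≡ f y → x ≡ y

module _ {n k ℓ} {Q : Pred (Fin n) ℓ} (Q? : U.Decidable Q) (χ : Fin n → Fin k) (χ-injective : InjectiveOn Q χ) where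

  private
    representative : Fin k → Maybe (Fin n)
    representative i with any? (λ x → Q? x ×-dec (χ x ≟ i))
    ... | yes (x , _) = just x
    ... | no _        = nothing

    representative-complete : ∀ {x} → Q x → MaybeAny.Any (x ≡_) (representative (χ x))
    representative-complete {x} Qx with any? (λ y → Q? y ×-dec (χ y ≟ χ x))
    ... | yes (y , Qy , χy≡χx) = MaybeAny.just (χ-injective Qx Qy (sym χy≡χx))
    ... | no ∄y                = ⊥-elim (∄y (x , Qx , refl))

  injectiveOn⇒boundedCover : ∃[ L ] (length L ≤ k × ∀ {x} → Q x → x ∈ₗ L)
  injectiveOn⇒boundedCover =
    mapMaybe representative (allFin k) ,
    ≤-trans (length-mapMaybe representative (allFin k)) (≤-reflexive (length-tabulate _)) ,
    λ Qx → mapMaybe⁺ representative (allFin k)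
             (map⁺ (Any.map (λ { refl → representative-complete Qx }) (∈-allFin _)))

-- Separating labellings

Separates : ∀ {n} → Rel (Fin n) 0ℓ → (Fin n → Bool) → Set
Separates R f = ∀ {x y} → R x y → ∃[ z ] (R x z × f z ≢ f x)

module _ {n} (R : Rel (Fin (suc n)) 0ℓ) (R? : Decidable R) (R-sym : Symmetric R) (R-irr : Irreflexive _≡_ R)
         {f⁺ : Fin n → Bool} (f⁺-separates : Separates (λ i j → R (suc i) (suc j)) f⁺) where

  private
    HasNeighbour⁺ : Fin n → Set
    HasNeighbour⁺ i = ∃[ j ] R (suc i) (suc j)

    hasNeighbour⁺? : ∀ i → Dec (HasNeighbour⁺ i)
    hasNeighbour⁺? i = any? (R? (suc i) ∘ suc)

    relabel : Bool → ∀ i → Dec (HasNeighbour⁺ i) → Bool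
    relabel b i (yes _) = f⁺ i
    relabel b i (no _)  = not b

    extend : Bool → Fin (suc n) → Bool
    extend b zero    = b
    extend b (suc i) = relabel b i (hasNeighbour⁺? i)

    opposite : Dec (∃[ j ] R zero (suc j)) → Bool
    opposite (yes (j , _)) = not (f⁺ j)
    opposite (no _)        = true

    relabel-hasNeighbour : ∀ {b i} → HasNeighbour⁺ i → ∀ d → relabel b i d ≡ f⁺ i
    relabel-hasNeighbour _        (yes _)     = refl
    relabel-hasNeighbour neighbour (no ∄neighbour) = ⊥-elim (∄neighbour neighbour)

    relabel-noNeighbour : ∀ {b i} → ¬ HasNeighbour⁺ i → ∀ d → relabel b i d ≡ not b
    relabel-noNeighbour ∄neighbour (yes neighbour) = ⊥-elim (∄neighbour neighbour)
    relabel-noNeighbour _          (no _)          = refl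

    separates-suc : ∀ b {i y} → R (suc i) y → ∃[ z ] (R (suc i) z × extend b z ≢ extend b (suc i))
    separates-suc b {i} {y} r with hasNeighbour⁺? i
    ... | yes (j , r⁺) =
      let z , r⁺z , f⁺z≢f⁺i = f⁺-separates r⁺ in
      suc z , r⁺z , subst (_≢ f⁺ i) (sym (relabel-hasNeighbour (i , R-sym r⁺z) (hasNeighbour⁺? z))) f⁺z≢f⁺i
    separates-suc b {i} {zero}  r | no _          = zero , r , not-¬ refl
    separates-suc b {i} {suc j} r | no ∄neighbour = ⊥-elim (∄neighbour (j , r))

    separates-zero : ∀ d {y} → R zero y → ∃[ z ] (R zero z × extend (opposite d) z ≢ opposite d)
    separates-zero (yes (j , r)) _ with hasNeighbour⁺? j
    ... | yes neighbour = suc j , r ,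
      subst (_≢ not (f⁺ j)) (sym (relabel-hasNeighbour neighbour (hasNeighbour⁺? j))) (not-¬ refl)
    ... | no ∄neighbour = suc j , r ,
      subst (_≢ not (f⁺ j)) (sym (relabel-noNeighbour ∄neighbour (hasNeighbour⁺? j))) (not-¬ refl ∘ sym)
    separates-zero (no ∄neighbour) {zero}  r = ⊥-elim (R-irr refl r)
    separates-zero (no ∄neighbour) {suc j} r = ⊥-elim (∄neighbour (j , r))

  -- Vertex 0 takes the label opposite to that of one of its neighbours, and the vertices
  -- whose only neighbour is 0 are relabelled to oppose vertex 0.
  separatingLabelling-extend : ∃[ f ] Separates R f
  separatingLabelling-extend = extend (opposite (any? (R? zero ∘ suc))) , separates
    where
    separates : Separates R (extend (opposite (any? (R? zero ∘ suc))))
    separates {zero}  = separates-zero (any? (R? zero ∘ suc))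
    separates {suc _} = separates-suc (opposite (any? (R? zero ∘ suc)))

separatingLabelling : ∀ {n} (R : Rel (Fin n) 0ℓ) → Decidable R → Symmetric R → Irreflexive _≡_ R →
                      ∃[ f ] Separates R f
separatingLabelling {zero}  R R? R-sym R-irr = (λ ()) , λ { {()} }
separatingLabelling {suc n} R R? R-sym R-irr = separatingLabelling-extend R R? R-sym R-irr
  (proj₂ (separatingLabelling (λ i j → R (suc i) (suc j)) (λ i j → R? (suc i) (suc j))
                              R-sym (R-irr ∘ cong suc)))

-- Leaves and rainbow paths

module _ {n} (Gr : SimpleGraph n) where
  open SimpleGraph Gr

  adj⇒≢ : ∀ {u v} → Adj u v → u ≢ v
  adj⇒≢ uv refl = irrefl uv

  IsLeafAt : Fin n → Fin n → Set
  IsLeafAt w t = t ≢ w × (∀ {y} → Adj t y → y ≡ w)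

  LeafEmbedding : Fin n → ℕ → Set
  LeafEmbedding w k = Σ (∀ t → IsLeafAt w t → Fin k) λ χ → ∀ {t t'} l l' → χ t l ≡ χ t' l' → t ≡ t'

  module _ {k} (c : EdgeColouring Gr k) where
    open EdgeColouring c renaming (sym to colour-sym)

    RainbowPath : Fin n → Fin n → Set
    RainbowPath u v = ∃[ p ] IsRainbowPath Gr c u v p

    rainbowPath-tail : ∀ {u v w x xs} → IsRainbowPath Gr c u v (w ∷ x ∷ xs) → IsRainbowPath Gr c x v (x ∷ xs)
    rainbowPath-tail (refl , last , (_ , walk) , _ ∷ unique , _ ∷ rainbow) = refl , last , walk , unique , rainbow

    edge⇒rainbowPath : ∀ {u v} → Adj u v → RainbowPath u v
    edge⇒rainbowPath uv = (_ ∷ _ ∷ []) , refl , refl , (uv , tt) , (adj⇒≢ uv ∷ []) ∷ [] ∷ [] , [] ∷ []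

    twoEdges⇒rainbowPath : ∀ {u m v} → Adj u m → Adj m v → u ≢ v → colour u m ≢ colour m v → RainbowPath u v
    twoEdges⇒rainbowPath um mv u≢v c₁≢c₂ =
      (_ ∷ _ ∷ _ ∷ []) , refl , refl , (um , mv , tt) ,
      (adj⇒≢ um ∷ u≢v ∷ []) ∷ (adj⇒≢ mv ∷ []) ∷ [] ∷ [] ,
      (c₁≢c₂ ∷ []) ∷ [] ∷ []

    threeEdges⇒rainbowPath : ∀ {u a b v} → Adj u a → Adj a b → Adj b v → u ≢ b → u ≢ v → a ≢ v →
      colour u a ≢ colour a b → colour u a ≢ colour b v → colour a b ≢ colour b v → RainbowPath u v
    threeEdges⇒rainbowPath ua ab bv u≢b u≢v a≢v c₁≢c₂ c₁≢c₃ c₂≢c₃ =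
      (_ ∷ _ ∷ _ ∷ _ ∷ []) , refl , refl , (ua , ab , bv , tt) ,
      (adj⇒≢ ua ∷ u≢b ∷ u≢v ∷ []) ∷ (adj⇒≢ ab ∷ a≢v ∷ []) ∷ (adj⇒≢ bv ∷ []) ∷ [] ∷ [] ,
      (c₁≢c₂ ∷ c₁≢c₃ ∷ []) ∷ (c₂≢c₃ ∷ []) ∷ [] ∷ []

    rainbowPath-meets-neighbourOfEnd : ∀ {u v} p → IsRainbowPath Gr c u v p → u ≢ v → Any (λ y → Adj y v) p
    rainbowPath-meets-neighbourOfEnd (_ ∷ [])    (refl , v≡u , _) u≢v = ⊥-elim (u≢v (sym v≡u))
    rainbowPath-meets-neighbourOfEnd {v = v} (u ∷ x ∷ xs) path@(_ , _ , (ux , _) , _) _ =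
      [ (λ { refl → here ux })
      , (λ x≢v → there (rainbowPath-meets-neighbourOfEnd (x ∷ xs) (rainbowPath-tail path) x≢v))
      ]′ (toSum (x ≟ v))

    -- A rainbow path between two leaves at w must be t, w, t': any longer path returns to w.
    leaves-distinctColours : IsRainbowConnected Gr c → ∀ {w t t'} → IsLeafAt w t → IsLeafAt w t' → t ≢ t' →
                             colour w t ≢ colour w t'
    leaves-distinctColours rainbow {w} {t} {t'} (_ , leaf) (_ , leaf') t≢t' with rainbow t t' t≢t'
    ... | (_ ∷ []) , (refl , t'≡t , _) = ⊥-elim (t≢t' (sym t'≡t))
    ... | (_ ∷ _ ∷ []) , (refl , refl , (tt' , _) , _) = ⊥-elim (t≢t' (trans (leaf' (symm tt')) (sym (leaf tt'))))
    ... | (_ ∷ a ∷ b ∷ rest) , path@(refl , _ , (ta , _) , _ ∷ (a∉ ∷ _) , (c₁≢c₂ ∷ _) ∷ _)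
      with leaf ta | b ≟ t'
    ...   | refl | yes refl = c₁≢c₂ ∘ trans (colour-sym t w)
    ...   | refl | no b≢t'  = ⊥-elim (All¬⇒¬Any a∉
            (Any.map (λ yt' → sym (leaf' (symm yt')))
              (rainbowPath-meets-neighbourOfEnd (b ∷ rest) (rainbowPath-tail (rainbowPath-tail path)) b≢t')))

    leafColour-injective : IsRainbowConnected Gr c → ∀ {w} → InjectiveOn (IsLeafAt w) (colour w)
    leafColour-injective rainbow {w} {t} {t'} leaf leaf' same =
      decidable-stable (t ≟ t') (λ t≢t' → leaves-distinctColours rainbow leaf leaf' t≢t' same)

-- Graphs with a dominating vertex

module _ {n} (Gr : SimpleGraph n) (adj? : Decidable (SimpleGraph.Adj Gr)) {w : Fin n}
         (dominating : ∀ {v} → v ≢ w → SimpleGraph.Adj Gr w v) where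
  open SimpleGraph Gr

  private
    Adj-w : Rel (Fin n) 0ℓ
    Adj-w x y = x ≢ w × y ≢ w × Adj x y

    Active : Fin n → Set
    Active x = ∃ (Adj-w x)

    adj-w? : Decidable Adj-w
    adj-w? x y = ¬? (x ≟ w) ×-dec ¬? (y ≟ w) ×-dec adj? x y

    active? : ∀ x → Dec (Active x)
    active? x = any? (adj-w? x)

    separating : ∃[ f ] Separates Adj-w f
    separating = separatingLabelling Adj-w adj-w?
      (λ (x≢w , y≢w , xy) → y≢w , x≢w , symm xy) (λ { refl (_ , _ , xx) → irrefl xx })

    label : Fin n → Bool
    label = proj₁ separating

    inactive⇒leaf : ∀ {x} → x ≢ w → ¬ Active x → IsLeafAt Gr w x
    inactive⇒leaf {x} x≢w inactive = x≢w , λ {y} xy → case y ≟ w of λ where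
      (yes y≡w) → y≡w
      (no y≢w)  → ⊥-elim (inactive (y , x≢w , y≢w , xy))

    inner : Fin 3
    inner = suc (suc zero)

    bitColour : Bool → Fin 3
    bitColour true  = zero
    bitColour false = suc zero

    bitColour≢inner : ∀ b → bitColour b ≢ inner
    bitColour≢inner true  ()
    bitColour≢inner false ()

    bitColour-injective : ∀ {a b} → bitColour a ≡ bitColour b → a ≡ b
    bitColour-injective {true}  {true}  _ = refl
    bitColour-injective {false} {false} _ = refl

  private
    module LeafColouring (χ : ∀ t → IsLeafAt Gr w t → Fin 3)
                         (χ-injective : ∀ {t t'} l l' → χ t l ≡ χ t' l' → t ≡ t') where
      vertexColourFrom : ∀ x → Dec (Active x) → Dec (x ≡ w) → Fin 3
      vertexColourFrom x (yes _) _        = bitColour (label x)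
      vertexColourFrom x (no _)  (yes _)  = zero
      vertexColourFrom x (no ¬a) (no x≢w) = χ x (inactive⇒leaf x≢w ¬a)

      vertexColour : Fin n → Fin 3
      vertexColour x = vertexColourFrom x (active? x) (x ≟ w)

      vertexColour-active : ∀ {x} → Active x → vertexColour x ≡ bitColour (label x)
      vertexColour-active {x} a = from (active? x) (x ≟ w)
        where
        from : ∀ d d′ → vertexColourFrom x d d′ ≡ bitColour (label x)
        from (yes _) _ = refl
        from (no ¬a) _ = ⊥-elim (¬a a)

      vertexColour-inactive : ∀ {x} → x ≢ w → ¬ Active x → ∃[ l ] vertexColour x ≡ χ x l
      vertexColour-inactive {x} x≢w ¬a = from (active? x) (x ≟ w)
        where
        from : ∀ d d′ → ∃[ l ] vertexColourFrom x d d′ ≡ χ x l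
        from (yes a)  _          = ⊥-elim (¬a a)
        from (no _)   (yes x≡w)  = ⊥-elim (x≢w x≡w)
        from (no ¬a′) (no x≢w′)  = inactive⇒leaf x≢w′ ¬a′ , refl

      edgeColourFrom : ∀ u v → Dec (u ≡ w) → Dec (v ≡ w) → Fin 3
      edgeColourFrom u v (yes _) _       = vertexColour v
      edgeColourFrom u v (no _)  (yes _) = vertexColour u
      edgeColourFrom u v (no _)  (no _)  = inner

      edgeColourFrom-sym : ∀ u v d d′ → edgeColourFrom u v d d′ ≡ edgeColourFrom v u d′ d
      edgeColourFrom-sym u v (yes u≡w) (yes v≡w) = cong vertexColour (trans v≡w (sym u≡w))
      edgeColourFrom-sym u v (yes _)   (no _)    = refl
      edgeColourFrom-sym u v (no _)    (yes _)   = refl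
      edgeColourFrom-sym u v (no _)    (no _)    = refl

      colouring : EdgeColouring Gr 3
      colouring = record
        { colour = λ u v → edgeColourFrom u v (u ≟ w) (v ≟ w)
        ; sym    = λ u v → edgeColourFrom-sym u v (u ≟ w) (v ≟ w)
        }

      open EdgeColouring colouring using (colour)

      colour-w-v : ∀ v → colour w v ≡ vertexColour v
      colour-w-v v with w ≟ w
      ... | yes _   = refl
      ... | no w≢w  = ⊥-elim (w≢w refl)

      colour-u-w : ∀ u → colour u w ≡ vertexColour u
      colour-u-w u = trans (EdgeColouring.sym colouring u w) (colour-w-v u)

      colour-inner : ∀ {u v} → u ≢ w → v ≢ w → colour u v ≡ inner
      colour-inner {u} {v} u≢w v≢w with u ≟ w | v ≟ w
      ... | yes u≡w | _       = ⊥-elim (u≢w u≡w)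
      ... | no _    | yes v≡w = ⊥-elim (v≢w v≡w)
      ... | no _    | no _    = refl

      detour : ∀ {x y} → Active x → vertexColour x ≡ vertexColour y →
               ∃[ z ] (Adj x z × z ≢ w × vertexColour z ≢ vertexColour y
                       × vertexColour z ≢ inner × vertexColour y ≢ inner)
      detour {x} {y} a@(_ , x-y′) x∼y with proj₂ separating x-y′
      ... | z , x-z@(x≢w , z≢w , xz) , label-z≢label-x =
        z , xz , z≢w ,
        label-z≢label-x ∘ bitColour-injective ∘ subst₂ _≡_ z-colour (trans (sym x∼y) x-colour) ,
        subst (_≢ inner) (sym z-colour) (bitColour≢inner (label z)) ,
        subst (_≢ inner) (trans (sym x-colour) x∼y) (bitColour≢inner (label x))
        where
        z-colour : vertexColour z ≡ bitColour (label z)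
        z-colour = vertexColour-active (x , z≢w , x≢w , symm xz)
        x-colour : vertexColour x ≡ bitColour (label x)
        x-colour = vertexColour-active a

      rainbowPath-avoiding-w : ∀ {u v} → u ≢ w → v ≢ w → u ≢ v → RainbowPath Gr colouring u v
      rainbowPath-avoiding-w {u} {v} u≢w v≢w u≢v with vertexColour u ≟ vertexColour v | active? u | active? v
      ... | no u≁v | _ | _ =
        twoEdges⇒rainbowPath Gr colouring (symm (dominating u≢w)) (dominating v≢w) u≢v
          (u≁v ∘ subst₂ _≡_ (colour-u-w u) (colour-w-v v))
      ... | yes u∼v | yes a | _ with detour a u∼v
      ...   | z , uz , z≢w , z≁v , z≢inner , v≢inner =
        threeEdges⇒rainbowPath Gr colouring uz (symm (dominating z≢w)) (dominating v≢w) u≢w u≢v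
          (z≁v ∘ cong vertexColour)
          (z≢inner ∘ sym ∘ subst₂ _≡_ (colour-inner u≢w z≢w) (colour-u-w z))
          (v≢inner ∘ sym ∘ subst₂ _≡_ (colour-inner u≢w z≢w) (colour-w-v v))
          (z≁v ∘ subst₂ _≡_ (colour-u-w z) (colour-w-v v))
      rainbowPath-avoiding-w {u} {v} u≢w v≢w u≢v | yes u∼v | no _ | yes a with detour a (sym u∼v)
      ...   | z , vz , z≢w , z≁u , z≢inner , u≢inner =
        threeEdges⇒rainbowPath Gr colouring (symm (dominating u≢w)) (dominating z≢w) (symm vz)
          (z≁u ∘ cong vertexColour ∘ sym) u≢v (v≢w ∘ sym)
          (z≁u ∘ sym ∘ subst₂ _≡_ (colour-u-w u) (colour-w-v z))
          (u≢inner ∘ subst₂ _≡_ (colour-u-w u) (colour-inner z≢w v≢w))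
          (z≢inner ∘ subst₂ _≡_ (colour-w-v z) (colour-inner z≢w v≢w))
      rainbowPath-avoiding-w {u} {v} u≢w v≢w u≢v | yes u∼v | no ¬a | no ¬a′
        with vertexColour-inactive u≢w ¬a | vertexColour-inactive v≢w ¬a′
      ...   | l , u-colour | l′ , v-colour =
        ⊥-elim (u≢v (χ-injective l l′ (trans (sym u-colour) (trans u∼v v-colour))))

  leafEmbedding⇒rc≤3 : LeafEmbedding Gr w 3 → rc≤ Gr 3
  leafEmbedding⇒rc≤3 (χ , χ-injective) = colouring , rainbow
    where
    open LeafColouring χ χ-injective

    rainbow : IsRainbowConnected Gr colouring
    rainbow u v u≢v with u ≟ w | v ≟ w
    ... | yes refl | _        = edge⇒rainbowPath Gr colouring (dominating (u≢v ∘ sym))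
    ... | no _     | yes refl = edge⇒rainbowPath Gr colouring (symm (dominating u≢v))
    ... | no u≢w   | no v≢w   = rainbowPath-avoiding-w u≢w v≢w u≢v

-- Commuting graphs

module _ (G : FinGroup) where
  open FinGroup G

  asGroup : Group 0ℓ 0ℓ
  asGroup = record
    { isGroup = record
      { isMonoid = record
        { isSemigroup = record
          { isMagma = record { isEquivalence = isEquivalence ; ∙-cong = cong₂ _∙_ }
          ; assoc   = assoc
          }
        ; identity = identityˡ , identityʳ
        }
      ; inverse = inverseˡ , inverseʳ
      ; ⁻¹-cong = cong inv
      }
    }

  open GroupProperties asGroup using (∙-cancelˡ; ε⁻¹≈ε; ⁻¹-injective)

  commute? : Decidable (Commute G)
  commute? a b = a ∙ b ≟ b ∙ a

  e-central : IsCentral G e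
  e-central a = trans (identityˡ a) (sym (identityʳ a))

  commute-inv : ∀ {a b} → Commute G a b → Commute G (inv a) b
  commute-inv {a} {b} ab = ∙-cancelˡ a _ _ (begin
    a ∙ (inv a ∙ b)  ≡⟨ assoc a (inv a) b ⟨
    (a ∙ inv a) ∙ b  ≡⟨ cong (_∙ b) (inverseʳ a) ⟩
    e ∙ b            ≡⟨ e-central b ⟩
    b ∙ e            ≡⟨ cong (b ∙_) (inverseʳ a) ⟨
    b ∙ (a ∙ inv a)  ≡⟨ assoc b a (inv a) ⟨
    (b ∙ a) ∙ inv a  ≡⟨ cong (_∙ inv a) ab ⟨
    (a ∙ b) ∙ inv a  ≡⟨ assoc a b (inv a) ⟩
    a ∙ (b ∙ inv a)  ∎)
    where open ≡-Reasoning

  commute-∙ : ∀ {a b c} → Commute G a c → Commute G b c → Commute G (a ∙ b) c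
  commute-∙ {a} {b} {c} ac bc = begin
    (a ∙ b) ∙ c  ≡⟨ assoc a b c ⟩
    a ∙ (b ∙ c)  ≡⟨ cong (a ∙_) bc ⟩
    a ∙ (c ∙ b)  ≡⟨ assoc a c b ⟨
    (a ∙ c) ∙ b  ≡⟨ cong (_∙ b) ac ⟩
    (c ∙ a) ∙ b  ≡⟨ assoc c a b ⟩
    c ∙ (a ∙ b)  ∎
    where open ≡-Reasoning

  open SimpleGraph (CG G) using (Adj)

  adj? : Decidable Adj
  adj? a b = ¬? (a ≟ b) ×-dec commute? a b

  e-dominating : ∀ {v} → v ≢ e → Adj e v
  e-dominating v≢e = v≢e ∘ sym , e-central _

  IsPendant : Fin order → Set
  IsPendant = IsLeafAt (CG G) e

  pendant? : U.Decidable IsPendant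
  pendant? t = map′ (λ (t≢e , f) → t≢e , λ {y} → f y) (λ (t≢e , f) → t≢e , λ y → f {y})
    (¬? (t ≟ e) ×-dec all? (λ y → adj? t y →-dec (y ≟ e)))

  pendant-centraliser : ∀ {t y} → IsPendant t → Commute G t y → y ≡ e ⊎ y ≡ t
  pendant-centraliser {t} {y} (_ , leaf) ty with t ≟ y
  ... | yes t≡y = inj₂ (sym t≡y)
  ... | no t≢y  = inj₁ (leaf (t≢y , ty))

  pendant-inv : ∀ {t} → IsPendant t → inv t ≡ t
  pendant-inv {t} p@(t≢e , _) with pendant-centraliser p (sym (commute-inv refl))
  ... | inj₁ t⁻¹≡e = ⊥-elim (t≢e (⁻¹-injective (trans t⁻¹≡e (sym ε⁻¹≈ε))))
  ... | inj₂ t⁻¹≡t = t⁻¹≡t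

  pendant-square : ∀ {t} → IsPendant t → t ∙ t ≡ e
  pendant-square {t} p = trans (cong (t ∙_) (sym (pendant-inv p))) (inverseʳ t)

  pendant⇒maxAbelianOfOrder2 : ∀ {t} → IsPendant t → IsMaxAbelianOfOrder2 G (⁅ e ⁆ ∪ ⁅ t ⁆)
  pendant⇒maxAbelianOfOrder2 {t} p@(t≢e , _) =
    ((subgroup , abelian) , maximal) , ∣⁅x⁆∪⁅y⁆∣≡2 (t≢e ∘ sym)
    where
    S : Subset order
    S = ⁅ e ⁆ ∪ ⁅ t ⁆

    e∈S : e ∈ S
    e∈S = x∈⁅x⁆∪⁅y⁆ e t

    t∈S : t ∈ S
    t∈S = y∈⁅x⁆∪⁅y⁆ e t

    elements : ∀ {a} → a ∈ S → a ≡ e ⊎ a ≡ t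
    elements = z∈⁅x⁆∪⁅y⁆⇒z≡x⊎z≡y e t

    subgroup : IsSubgroup G S
    subgroup = e∈S , closed , inverses
      where
      closed : ∀ {a b} → a ∈ S → b ∈ S → (a ∙ b) ∈ S
      closed {a} {b} a∈S b∈S with elements a∈S | elements b∈S
      ... | inj₁ refl | _         = subst (_∈ S) (sym (identityˡ b)) b∈S
      ... | inj₂ refl | inj₁ refl = subst (_∈ S) (sym (identityʳ t)) t∈S
      ... | inj₂ refl | inj₂ refl = subst (_∈ S) (sym (pendant-square p)) e∈S

      inverses : ∀ {a} → a ∈ S → inv a ∈ S
      inverses a∈S with elements a∈S
      ... | inj₁ refl = subst (_∈ S) (sym ε⁻¹≈ε) e∈S
      ... | inj₂ refl = subst (_∈ S) (sym (pendant-inv p)) t∈S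

    abelian : ∀ {a b} → a ∈ S → b ∈ S → Commute G a b
    abelian {a} {b} a∈S b∈S with elements a∈S | elements b∈S
    ... | inj₁ refl | _         = e-central b
    ... | inj₂ refl | inj₁ refl = sym (e-central t)
    ... | inj₂ refl | inj₂ refl = refl

    maximal : ∀ T → IsAbelianSubgroup G T → S ⊆ T → T ⊆ S
    maximal T (_ , abelianT) S⊆T y∈T with pendant-centraliser p (abelianT (S⊆T t∈S) y∈T)
    ... | inj₁ refl = e∈S
    ... | inj₂ refl = t∈S

  -- The centre of the centraliser of {a, b}.
  commuting⇒abelianSubgroup : ∀ {a b} → Commute G a b → ∃[ T ] (IsAbelianSubgroup G T × a ∈ T × b ∈ T)
  commuting⇒abelianSubgroup {a} {b} ab = subset member? , (subgroup , abelian) , ∈⁺ a-member , ∈⁺ b-member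
    where
    Member : Fin order → Set
    Member x = Commute G x a × Commute G x b × (∀ c → Commute G c a → Commute G c b → Commute G x c)

    member? : U.Decidable Member
    member? x =
      commute? x a ×-dec commute? x b ×-dec all? (λ c → commute? c a →-dec commute? c b →-dec commute? x c)

    ∈⁺ : ∀ {x} → Member x → x ∈ subset member?
    ∈⁺ = ∈-subset⁺ member?

    ∈⁻ : ∀ {x} → x ∈ subset member? → Member x
    ∈⁻ = ∈-subset⁻ member?

    a-member : Member a
    a-member = refl , ab , λ _ ca _ → sym ca

    b-member : Member b
    b-member = sym ab , refl , λ _ _ cb → sym cb

    subgroup : IsSubgroup G (subset member?)
    subgroup = ∈⁺ (e-central a , e-central b , λ c _ _ → e-central c) , closed , inverses
      where
      closed : ∀ {x y} → x ∈ subset member? → y ∈ subset member? → (x ∙ y) ∈ subset member?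
      closed x∈ y∈ with ∈⁻ x∈ | ∈⁻ y∈
      ... | xa , xb , x-central | ya , yb , y-central =
        ∈⁺ (commute-∙ xa ya , commute-∙ xb yb , λ c ca cb → commute-∙ (x-central c ca cb) (y-central c ca cb))

      inverses : ∀ {x} → x ∈ subset member? → inv x ∈ subset member?
      inverses x∈ with ∈⁻ x∈
      ... | xa , xb , x-central =
        ∈⁺ (commute-inv xa , commute-inv xb , λ c ca cb → commute-inv (x-central c ca cb))

    abelian : ∀ {x y} → x ∈ subset member? → y ∈ subset member? → Commute G x y
    abelian x∈ y∈ with ∈⁻ x∈ | ∈⁻ y∈
    ... | _ , _ , x-central | ya , yb , _ = x-central _ ya yb

  maxAbelianOfOrder2⇒pendant : ∀ {S} → IsMaxAbelianOfOrder2 G S → ∃[ t ] (IsPendant t × S ≡ ⁅ e ⁆ ∪ ⁅ t ⁆)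
  maxAbelianOfOrder2⇒pendant {S} ((((e∈S , _) , _) , maximal) , ∣S∣≡2) with ∣p∣≡2⇒p≡⁅x⁆∪⁅y⁆ ∣S∣≡2 e∈S
  ... | t , t≢e , refl = t , (t≢e , leaf) , refl
    where
    leaf : ∀ {y} → Adj t y → y ≡ e
    leaf {y} (t≢y , ty) with commuting⇒abelianSubgroup ty
    ... | T , abelianT@((e∈T , _) , _) , t∈T , y∈T
      with z∈⁅x⁆∪⁅y⁆⇒z≡x⊎z≡y e t (maximal T abelianT (⁅x⁆∪⁅y⁆⊆p e∈T t∈T) y∈T)
    ...   | inj₁ y≡e = y≡e
    ...   | inj₂ y≡t = ⊥-elim (t≢y (sym y≡t))

  nontrivialCenter? : Dec (NontrivialCenter G)
  nontrivialCenter? = any? (λ z → ¬? (z ≟ e) ×-dec all? (commute? z))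

  ¬nontrivialCenter⇒trivialCenter : ¬ NontrivialCenter G → TrivialCenter G
  ¬nontrivialCenter⇒trivialCenter ∄z z central = decidable-stable (z ≟ e) (λ z≢e → ∄z (z , z≢e , central))

  -- A pendant commutes with the central z ≠ e, so it is z, and then every element is e or z.
  nontrivialCenter⇒noPendant : ¬ IsAbelian G → NontrivialCenter G → ∀ {t} → ¬ IsPendant t
  nontrivialCenter⇒noPendant nonabelian (z , z≢e , z-central) {t} p with pendant-centraliser p (sym (z-central t))
  ... | inj₁ z≡e = z≢e z≡e
  ... | inj₂ refl = nonabelian λ a b → case pendant-centraliser p (z-central a) of λ where
    (inj₁ refl) → e-central b
    (inj₂ refl) → z-central b

  pendantColouring⇒maxAbelianCover : ∀ {k} (χ : Fin order → Fin k) → InjectiveOn IsPendant χ →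
    ∃[ L ] (length L ≤ k × ∀ S → IsMaxAbelianOfOrder2 G S → S ∈ₗ L)
  pendantColouring⇒maxAbelianCover χ χ-injective with injectiveOn⇒boundedCover pendant? χ χ-injective
  ... | L , |L|≤k , cover =
    map (λ t → ⁅ e ⁆ ∪ ⁅ t ⁆) L ,
    ≤-trans (≤-reflexive (length-map _ L)) |L|≤k ,
    λ S max → case maxAbelianOfOrder2⇒pendant max of λ where
      (t , p , refl) → ∈-map⁺ _ (cover p)

  maxAbelianCover⇒pendantEmbedding : ∀ {k} (L : List (Subset order)) → length L ≤ k →
    (∀ S → IsMaxAbelianOfOrder2 G S → S ∈ₗ L) → LeafEmbedding (CG G) e k
  maxAbelianCover⇒pendantEmbedding L |L|≤k cover = position , position-injective
    where
    listed : ∀ {t} → IsPendant t → ⁅ e ⁆ ∪ ⁅ t ⁆ ∈ₗ L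
    listed p = cover _ (pendant⇒maxAbelianOfOrder2 p)

    position : ∀ t → IsPendant t → Fin _
    position t p = inject≤ (Any.index (listed p)) |L|≤k

    position-injective : ∀ {t t'} p p' → position t p ≡ position t' p' → t ≡ t'
    position-injective {t} {t'} p@(t≢e , _) p' same =
      [ ⊥-elim ∘ t≢e , id ]′ (z∈⁅x⁆∪⁅y⁆⇒z≡x⊎z≡y e t' (subst (t ∈_) same-pair (y∈⁅x⁆∪⁅y⁆ e t)))
      where
      same-pair : ⁅ e ⁆ ∪ ⁅ t ⁆ ≡ ⁅ e ⁆ ∪ ⁅ t' ⁆
      same-pair = begin
        ⁅ e ⁆ ∪ ⁅ t ⁆                          ≡⟨ lookup-index (listed p) ⟩
        List.lookup L (Any.index (listed p))   ≡⟨ cong (List.lookup L) (inject≤-injective _ _ _ _ same) ⟩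
        List.lookup L (Any.index (listed p'))  ≡⟨ lookup-index (listed p') ⟨
        ⁅ e ⁆ ∪ ⁅ t' ⁆                         ∎
        where open ≡-Reasoning

theorem3 : (G : FinGroup) → ¬ IsAbelian G →
    (rc≤ (CG G) 3 ⇔ (NontrivialCenter G ⊎ (TrivialCenter G × AtMostThreeMaxAbelianOfOrder2 G)))
theorem3 G nonabelian = mk⇔ forward backward
  where
  open FinGroup G using (e)

  forward : rc≤ (CG G) 3 → NontrivialCenter G ⊎ (TrivialCenter G × AtMostThreeMaxAbelianOfOrder2 G)
  forward (c , rainbow) with nontrivialCenter? G
  ... | yes nontrivial = inj₁ nontrivial
  ... | no ¬nontrivial = inj₂ (¬nontrivialCenter⇒trivialCenter G ¬nontrivial ,
    pendantColouring⇒maxAbelianCover G (EdgeColouring.colour c e) (leafColour-injective (CG G) c rainbow))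

  backward : NontrivialCenter G ⊎ (TrivialCenter G × AtMostThreeMaxAbelianOfOrder2 G) → rc≤ (CG G) 3
  backward (inj₁ nontrivial) = leafEmbedding⇒rc≤3 (CG G) (adj? G) (e-dominating G)
    ((λ t p → ⊥-elim (noPendant p)) , λ p _ _ → ⊥-elim (noPendant p))
    where
    noPendant : ∀ {t} → ¬ IsPendant G t
    noPendant = nontrivialCenter⇒noPendant G nonabelian nontrivial
  backward (inj₂ (_ , L , |L|≤3 , cover)) =
    leafEmbedding⇒rc≤3 (CG G) (adj? G) (e-dominating G) (maxAbelianCover⇒pendantEmbedding G L |L|≤3 cover)
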